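{- Let $n$ be an even Zumkeller number. If $\sigma(n)<3n$, then $n$ is a half-Zumkeller number.
   Context: $\sigma(n)$ denotes the sum of all positive divisors of $n$. A positive integer $n$ is a Zumkeller number if the set of all positive divisors of $n$ can be partitioned into two disjoint parts whose sums are equal. A positive integer $n$ is a half-Zumkeller number if the set of all positive divisors of $n$ other than $n$ itself can be partitioned into two disjoint parts whose sums are equal. -}

module Defs where

open import Data.Nat using (ℕ; zero; suc; _+_; _*_; _<_)
open import Data.Nat.Divisibility using (_∣_; _∣?_)
open import Data.Nat.Properties using (_≟_)
open import Data.Bool using (Bool; true; false; if_then_else_)
open import Data.List using (List; []; _∷_; filter; upTo; map; length; zip)
open import Data.Nat.ListAction using (sum)
open import Data.Product using (Σ; _×_; _,_)
open import Relation.Binary.PropositionalEquality using (_≡_)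
open import Relation.Nullary using (¬_)
open import Relation.Nullary.Decidable using (¬?)

divisors : ℕ → List ℕ
divisors n = filter (_∣? n) (map suc (upTo n))

properDivisors : ℕ → List ℕ
properDivisors n = filter (λ d → ¬? (d ≟ n)) (divisors n)

σ : ℕ → ℕ
σ n = sum (divisors n)

partSum : Bool → List (ℕ × Bool) → ℕ
partSum b [] = 0
partSum true  ((x , true)  ∷ xs) = x + partSum true xs
partSum true  ((x , false) ∷ xs) = partSum true xs
partSum false ((x , true)  ∷ xs) = partSum false xs
partSum false ((x , false) ∷ xs) = x + partSum false xs

EqualSumPartition : List ℕ → Set
EqualSumPartition ds =
  Σ (List Bool) λ labels →
    (length labels ≡ length ds) ×
    (partSum true (zip ds labels) ≡ partSum false (zip ds labels))

Zumkeller : ℕ → Set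
Zumkeller n = (0 < n) × EqualSumPartition (divisors n)

HalfZumkeller : ℕ → Set
HalfZumkeller n = (0 < n) × EqualSumPartition (properDivisors n)

module Submission where

-- Write n = 2q and fix an equal-sum partition of the divisors of n.
-- The divisors n and q must lie in different parts: otherwise the part holding
-- them has sum at least n + q = 3q, so σ(n) = 2·(that sum) ≥ 6q = 3n.  Hence
-- deleting n from its part and moving q into that part lowers both part sums by
-- exactly q, which gives an equal-sum partition of the proper divisors.

open import Defs
open import Data.Nat using (ℕ; zero; suc; _+_; _*_; _<_; _≤_; s≤s; z≤n)
open import Data.Nat.Properties
  using (_≟_; suc-injective; +-cancelˡ-≡; +-comm; +-assoc; +-commutativeSemigroup;
         ≤-refl; m≤m+n; m≤m*n; m<m*n; <⇒≱; <⇒≢)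
open import Data.Nat.Divisibility using (_∣_; _∣?_; divides; ∣-refl; m∣m*n)
open import Data.Nat.ListAction using (sum)
open import Data.Nat.Tactic.RingSolver using (solve-∀)
open import Data.Bool using (Bool; true; false; if_then_else_)
open import Data.List using (List; []; _∷_; filter; map; length; zip)
open import Data.List.Properties using (filter-accept; filter-reject; filter-all; map-∘)
import Data.List.Relation.Unary.All as All
import Data.List.Relation.Unary.All.Properties as All
open import Data.List.Relation.Unary.Any using (here; there)
open import Data.List.Relation.Unary.AllPairs using (_∷_)
open import Data.List.Relation.Unary.Unique.Propositional using (Unique)
import Data.List.Relation.Unary.Unique.Propositional.Properties as Unique
open import Data.List.Membership.Propositional using (_∈_)
open import Data.List.Membership.Propositional.Properties
  using (∈-map⁺; ∈-map⁻; ∈-filter⁺; ∈-upTo⁺)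
open import Data.Product using (Σ; ∃; _×_; _,_; proj₁; proj₂)
open import Data.Empty using (⊥-elim)
open import Function using (_∘_)
open import Relation.Binary.PropositionalEquality
open import Relation.Nullary using (¬_; Dec; yes; no; does)
open import Relation.Nullary.Decidable using (¬?; dec-true; dec-false)

open import Algebra.Properties.CommutativeSemigroup +-commutativeSemigroup
  using () renaming (x∙yz≈y∙xz to +-exchange)

open ≡-Reasoning

Labelled : Set
Labelled = List (ℕ × Bool)

keys : Labelled → List ℕ
keys = map proj₁

Balanced : Labelled → Set
Balanced ps = partSum true ps ≡ partSum false ps

total : Labelled → ℕ
total ps = partSum true ps + partSum false ps

total≡sum : ∀ ps → total ps ≡ sum (keys ps)
total≡sum [] = refl
total≡sum ((x , true) ∷ ps) = trans (+-assoc x _ _) (cong (x +_) (total≡sum ps))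
total≡sum ((x , false) ∷ ps) =
  trans (+-exchange (partSum true ps) x _) (cong (x +_) (total≡sum ps))

partition⇒balanced : ∀ xs → EqualSumPartition xs → Σ Labelled λ ps → keys ps ≡ xs × Balanced ps
partition⇒balanced xs (ls , len , eq) = zip xs ls , keys-zip xs ls len , eq
  where
  keys-zip : ∀ xs (ls : List Bool) → length ls ≡ length xs → keys (zip xs ls) ≡ xs
  keys-zip [] [] _ = refl
  keys-zip (x ∷ xs) (l ∷ ls) e = cong (x ∷_) (keys-zip xs ls (suc-injective e))

balanced⇒partition : ∀ ps xs → keys ps ≡ xs → Balanced ps → EqualSumPartition xs
balanced⇒partition ps _ refl bal = map proj₂ ps , length-labels ps , subst Balanced (sym (zip-keys ps)) bal
  where
  length-labels : ∀ ps → length (map proj₂ ps) ≡ length (keys ps)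
  length-labels [] = refl
  length-labels (_ ∷ ps) = cong suc (length-labels ps)
  zip-keys : ∀ ps → zip (keys ps) (map proj₂ ps) ≡ ps
  zip-keys [] = refl
  zip-keys (p ∷ ps) = cong (p ∷_) (zip-keys ps)

record _≋_ (ps qs : Labelled) : Set where
  constructor same-sums
  field part≡ : ∀ b → partSum b ps ≡ partSum b qs
open _≋_

≡⇒≋ : ∀ {ps qs} → ps ≡ qs → ps ≋ qs
≡⇒≋ e = same-sums λ b → cong (partSum b) e

≋-sym : ∀ {ps qs} → ps ≋ qs → qs ≋ ps
≋-sym e = same-sums λ b → sym (part≡ e b)

≋-trans : ∀ {ps qs rs} → ps ≋ qs → qs ≋ rs → ps ≋ rs
≋-trans p q = same-sums λ b → trans (part≡ p b) (part≡ q b)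

∷-≋ : ∀ p {ps qs} → ps ≋ qs → (p ∷ ps) ≋ (p ∷ qs)
∷-≋ (x , l) e = same-sums (cons l)
  where
  cons : ∀ l b → partSum b ((x , l) ∷ _) ≡ partSum b ((x , l) ∷ _)
  cons true true = cong (x +_) (part≡ e true)
  cons true false = part≡ e false
  cons false true = part≡ e true
  cons false false = cong (x +_) (part≡ e false)

swap-≋ : ∀ p q ps → (p ∷ q ∷ ps) ≋ (q ∷ p ∷ ps)
swap-≋ (x , l) (y , m) ps = same-sums (exchange l m)
  where
  exchange : ∀ l m b → partSum b ((x , l) ∷ (y , m) ∷ ps) ≡ partSum b ((y , m) ∷ (x , l) ∷ ps)
  exchange true true true = +-exchange x y _
  exchange false false false = +-exchange x y _
  exchange true true false = refl
  exchange true false true = refl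
  exchange true false false = refl
  exchange false true true = refl
  exchange false true false = refl
  exchange false false true = refl

≋-balanced : ∀ {ps qs} → ps ≋ qs → Balanced ps → Balanced qs
≋-balanced e bal = trans (sym (part≡ e true)) (trans bal (part≡ e false))

≋-total : ∀ {ps qs} → ps ≋ qs → total ps ≡ total qs
≋-total e = cong₂ _+_ (part≡ e true) (part≡ e false)

notKey? : (x : ℕ) (p : ℕ × Bool) → Dec (¬ proj₁ p ≡ x)
notKey? x p = ¬? (proj₁ p ≟ x)

remove : ℕ → Labelled → Labelled
remove x = filter (notKey? x)

keys-remove : ∀ x ps → keys (remove x ps) ≡ filter (λ d → ¬? (d ≟ x)) (keys ps)
keys-remove x [] = refl
keys-remove x ((y , l) ∷ ps) with y ≟ x
... | yes y≡x = trans (cong keys (filter-reject (notKey? x) (λ k → k y≡x)))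
                (trans (keys-remove x ps) (sym (filter-reject (λ d → ¬? (d ≟ x)) (λ k → k y≡x))))
... | no y≢x = trans (cong keys (filter-accept (notKey? x) y≢x))
               (trans (cong (y ∷_) (keys-remove x ps)) (sym (filter-accept (λ d → ¬? (d ≟ x)) y≢x)))

extract : ∀ {x c} ps → Unique (keys ps) → (x , c) ∈ ps → ps ≋ ((x , c) ∷ remove x ps)
extract ((x , c) ∷ ps) (fresh ∷ _) (here refl) =
  ≡⇒≋ (cong ((x , c) ∷_) (sym removed))
  where
  removed : remove x ((x , c) ∷ ps) ≡ ps
  removed = trans (filter-reject (notKey? x) (λ k → k refl))
                  (filter-all (notKey? x) (All.map⁻ (All.map (_∘ sym) fresh)))
extract {x} {c} ((y , l) ∷ ps) (fresh ∷ uniq) (there m) =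
  ≋-trans (∷-≋ (y , l) (extract ps uniq m))
  (≋-trans (swap-≋ (y , l) (x , c) (remove x ps))
  (≡⇒≋ (cong ((x , c) ∷_) (sym (filter-accept (notKey? x) y≢x)))))
  where
  y≢x : ¬ y ≡ x
  y≢x = All.lookup fresh (∈-map⁺ proj₁ m)

relabelAt : ℕ → Bool → ℕ × Bool → ℕ × Bool
relabelAt x c p = proj₁ p , (if does (proj₁ p ≟ x) then c else proj₂ p)

relabel : ℕ → Bool → Labelled → Labelled
relabel x c = map (relabelAt x c)

keys-relabel : ∀ x c ps → keys (relabel x c ps) ≡ keys ps
keys-relabel x c ps = sym (map-∘ ps)

remove-relabel : ∀ x c ps → remove x (relabel x c ps) ≡ remove x ps
remove-relabel x c [] = refl
remove-relabel x c ((y , l) ∷ ps) with y ≟ x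
... | yes y≡x = trans (filter-reject (notKey? x) (λ k → k y≡x))
                (trans (remove-relabel x c ps) (sym (filter-reject (notKey? x) (λ k → k y≡x))))
... | no y≢x = begin
  remove x (relabelAt x c (y , l) ∷ relabel x c ps)
    ≡⟨ cong (λ t → remove x ((y , (if t then c else l)) ∷ relabel x c ps)) (dec-false (y ≟ x) y≢x) ⟩
  remove x ((y , l) ∷ relabel x c ps)  ≡⟨ filter-accept (notKey? x) y≢x ⟩
  (y , l) ∷ remove x (relabel x c ps)  ≡⟨ cong ((y , l) ∷_) (remove-relabel x c ps) ⟩
  (y , l) ∷ remove x ps                ≡⟨ filter-accept (notKey? x) y≢x ⟨
  remove x ((y , l) ∷ ps)              ∎

relabel-extract : ∀ {x c c'} ps → Unique (keys ps) → (x , c') ∈ ps →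
                  relabel x c ps ≋ ((x , c) ∷ remove x ps)
relabel-extract {x} {c} {c'} ps uniq m =
  ≋-trans (extract (relabel x c ps) (subst Unique (sym (keys-relabel x c ps)) uniq) relabelled∈)
  (≡⇒≋ (cong ((x , c) ∷_) (remove-relabel x c ps)))
  where
  relabelled∈ : (x , c) ∈ relabel x c ps
  relabelled∈ = subst (_∈ relabel x c ps)
                  (cong (λ t → x , (if t then c else c')) (dec-true (x ≟ x) refl))
                  (∈-map⁺ (relabelAt x c) m)

label-of : ∀ {x} ps → x ∈ keys ps → ∃ λ c → (x , c) ∈ ps
label-of ps m with ∈-map⁻ proj₁ m
... | (_ , c) , m' , refl = c , m'

-- A part containing both x and 2x has sum at least 3x, so the total is at least 6x.
same-part-too-large : ∀ x T U → x * 2 + (x + T) ≡ U → ¬ (x * 2 + (x + T)) + U < 3 * (x * 2)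
same-part-too-large x T U refl small =
  <⇒≱ small (subst (3 * (x * 2) ≤_) (doubled x T) (m≤m+n (3 * (x * 2)) (T + T)))
  where
  doubled : ∀ x T → 3 * (x * 2) + (T + T) ≡ x * 2 + (x + T) + (x * 2 + (x + T))
  doubled = solve-∀

shed-half : ∀ x T U → x * 2 + T ≡ x + U → x + T ≡ U
shed-half x T U e = +-cancelˡ-≡ x _ _ (trans (double-split x T) e)
  where
  double-split : ∀ x T → x + (x + T) ≡ x * 2 + T
  double-split = solve-∀

move-half-balanced : ∀ x c c' D → Balanced ((x * 2 , c) ∷ (x , c') ∷ D) →
                     total ((x * 2 , c) ∷ (x , c') ∷ D) < 3 * (x * 2) →
                     Balanced ((x , c) ∷ D)
move-half-balanced x true true D bal small =
  ⊥-elim (same-part-too-large x (partSum true D) (partSum false D) bal small)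
move-half-balanced x false false D bal small =
  ⊥-elim (same-part-too-large x (partSum false D) (partSum true D) (sym bal)
           (subst (_< 3 * (x * 2)) (+-comm (partSum true D) _) small))
move-half-balanced x true false D bal _ = shed-half x (partSum true D) (partSum false D) bal
move-half-balanced x false true D bal _ = sym (shed-half x (partSum false D) (partSum true D) (sym bal))

half≢double : ∀ x → 0 < x → x ≢ x * 2
half≢double x@(suc _) _ = <⇒≢ (m<m*n x 2 (s≤s (s≤s z≤n)))

remove-double : ∀ x xs → Unique xs → x * 2 ∈ xs → x ∈ xs → 0 < x → sum xs < 3 * (x * 2) →
                EqualSumPartition xs → EqualSumPartition (filter (λ d → ¬? (d ≟ x * 2)) xs)
remove-double x xs uniq double∈ half∈ x>0 small part
  with ps , keys≡xs , bal ← partition⇒balanced xs part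
  with c , double∈ps ← label-of ps (subst (x * 2 ∈_) (sym keys≡xs) double∈)
  with c' , half∈ps ← label-of ps (subst (x ∈_) (sym keys≡xs) half∈) =
  balanced⇒partition moved _ keys-moved (≋-balanced (≋-sym moved-shape)
    (move-half-balanced x c c' rest (≋-balanced shape bal) (subst (_< 3 * (x * 2)) total-shape small)))
  where
  uniq-ps : Unique (keys ps)
  uniq-ps = subst Unique (sym keys≡xs) uniq
  others rest : Labelled
  others = remove (x * 2) ps
  rest = remove x others
  half∈others : (x , c') ∈ others
  half∈others = ∈-filter⁺ (notKey? (x * 2)) half∈ps (half≢double x x>0)
  uniq-others : Unique (keys others)
  uniq-others = subst Unique (sym (keys-remove (x * 2) ps)) (Unique.filter⁺ _ uniq-ps)
  shape : ps ≋ ((x * 2 , c) ∷ (x , c') ∷ rest)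
  shape = ≋-trans (extract ps uniq-ps double∈ps)
            (∷-≋ (x * 2 , c) (extract others uniq-others half∈others))
  total-shape : sum xs ≡ total ((x * 2 , c) ∷ (x , c') ∷ rest)
  total-shape = trans (cong sum (sym keys≡xs)) (trans (sym (total≡sum ps)) (≋-total shape))
  moved : Labelled
  moved = relabel x c others
  moved-shape : moved ≋ ((x , c) ∷ rest)
  moved-shape = relabel-extract others uniq-others half∈others
  keys-moved : keys moved ≡ filter (λ d → ¬? (d ≟ x * 2)) xs
  keys-moved = trans (keys-relabel x c others) (trans (keys-remove (x * 2) ps) (cong (filter _) keys≡xs))

divisors-unique : ∀ n → Unique (divisors n)
divisors-unique n = Unique.filter⁺ (_∣? n) (Unique.map⁺ suc-injective (Unique.upTo⁺ n))

∈-divisors : ∀ {d n} → 0 < d → d ≤ n → d ∣ n → d ∈ divisors n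
∈-divisors {suc _} _ d≤n d∣n = ∈-filter⁺ (_∣? _) (∈-map⁺ suc (∈-upTo⁺ d≤n)) d∣n

mainTheorem8 : (n : ℕ) → 2 ∣ n → Zumkeller n → σ n < 3 * n → HalfZumkeller n
mainTheorem8 _ (divides zero refl) (() , _) _
mainTheorem8 n (divides q@(suc _) refl) (n>0 , part) σ<3n =
  n>0 , remove-double q (divisors n) (divisors-unique n)
          (∈-divisors n>0 ≤-refl ∣-refl) (∈-divisors (s≤s z≤n) (m≤m*n q 2) (m∣m*n 2))
          (s≤s z≤n) σ<3n part
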